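{- Let $(W_r)_{r\in\mathbb{Z}}$ be a generalized Tribonacci sequence and $(K_r)_{r\in\mathbb{Z}}$ the Tribonacci-Lucas sequence. For all integers $a,b,c,d,e$, \[ \begin{split} \{K_{b-a-1}K_{a-b-1}+&K_{b-a-1}K_{c-b-1}K_{a-c-1}+K_{c-a-1}K_{b-c-1}K_{a-b-1}\\ &+K_{c-a-1}K_{a-c-1}+K_{c-b-1}K_{b-c-1}-1\}W_{d+e}\\ &=\{(1-K_{c-b-1}K_{b-c-1})K_{e-a}+(K_{b-a-1}+K_{c-a-1}K_{b-c-1})K_{e-b}\\ &\qquad+(K_{c-a-1}+K_{b-a-1}K_{c-b-1})K_{e-c}\}W_{d+a-1}\\ &\quad+\{(1-K_{c-a-1}K_{a-c-1})K_{e-b}+(K_{a-b-1}+K_{c-b-1}K_{a-c-1})K_{e-a}\\ &\qquad+(K_{c-b-1}+K_{c-a-1}K_{a-b-1})K_{e-c}\}W_{d+b-1}\\ &\quad+\{(1-K_{b-a-1}K_{a-b-1})K_{e-c}+(K_{b-c-1}+K_{b-a-1}K_{a-c-1})K_{e-b}\\ &\qquad+(K_{a-c-1}+K_{b-c-1}K_{a-b-1})K_{e-a}\}W_{d+c-1}. \end{split} \]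
   Context: Let $W_0,W_1,W_2$ be arbitrary integers, not all zero. The generalized Tribonacci numbers $(W_r)_{r\in\mathbb{Z}}$ are defined by $W_r=W_{r-1}+W_{r-2}+W_{r-3}$ for $r\ge 3$, and extended to negative indices by $W_{ -r}=W_{ -r+3}-W_{ -r+2}-W_{ -r+1}$ (so the recurrence holds for all $r\in\mathbb{Z}$). The Tribonacci-Lucas numbers $(K_r)_{r\in\mathbb{Z}}$ are the special case $K_0=3$, $K_1=1$, $K_2=3$. -}

module Defs where

open import Data.Nat using (ℕ; zero; suc)
open import Data.Integer using (ℤ; +_; -[1+_]; _+_; _-_)
open import Data.Product using (_×_; _,_; proj₁)

-- Forward triples: fwd a b c n = (W_n, W_{n+1}, W_{n+2}) when (a,b,c) = (W_0,W_1,W_2).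
fwd : ℤ → ℤ → ℤ → ℕ → ℤ × ℤ × ℤ
fwd a b c zero = a , b , c
fwd a b c (suc n) with fwd a b c n
... | x , y , z = y , z , (x + y + z)

-- Backward triples: bwd a b c n = (W_{-n}, W_{-n+1}, W_{-n+2}).
-- Uses W_{r-3} = W_r - W_{r-1} - W_{r-2}.
bwd : ℤ → ℤ → ℤ → ℕ → ℤ × ℤ × ℤ
bwd a b c zero = a , b , c
bwd a b c (suc n) with bwd a b c n
... | x , y , z = (z - y - x) , x , y

W : ℤ → ℤ → ℤ → ℤ → ℤ
W a b c (+ n) = proj₁ (fwd a b c n)
W a b c -[1+ n ] = proj₁ (bwd a b c (suc n))

K : ℤ → ℤ
K = W (+ 3) (+ 1) (+ 3)

open import Relation.Binary.PropositionalEquality using (_≡_)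
open import Relation.Nullary using (¬_)

¬AllZero : ℤ → ℤ → ℤ → Set
¬AllZero a b c = ¬ ((a ≡ + 0) × (b ≡ + 0) × (c ≡ + 0))

-- Every Tribonacci sequence f satisfies the addition formula
-- f (m + n) = (f m , f (m + 1) , f (m + 2)) · (A n , B n , C n), where A, B, C are the
-- Tribonacci sequences starting from the unit vectors. With p x the window of K at - x and
-- v y = (A , B , C) (y - 1) this gives p x · v y = K (y - x - 1), a Gram matrix with diagonal
-- K (-1) = -1, while the window of W at d pairs with v y to W (d + y - 1) and with
-- (A , B , C) e to W (d + e). The identity is Cramer's rule for (A , B , C) e in the basis
-- v a, v b, v c, multiplied by det (p a , p b , p c) to turn every determinant into a Gram
-- determinant and paired with the window of W; expanding along the diagonal -1 gives the
-- stated coefficients. Only the recurrence and K (-1) = -1 are used, so the identity holds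
-- for every Tribonacci W, zero or not.

module Submission where

open import Algebra.Bundles.Raw using (RawRing)
open import Data.Nat using (ℕ; suc)
open import Data.Integer using (ℤ; +_; -[1+_]; -1ℤ; +-*-rawRing)
open import Data.Integer.Properties
  using (+-identityʳ; +-inverseʳ; +-comm; +-assoc; *-assoc; +-commutativeSemigroup)
open import Algebra.Properties.CommutativeSemigroup +-commutativeSemigroup using (x∙yz≈y∙xz)
open import Data.Integer.Solver using (module +-*-Solver)
open import Data.Integer.Tactic.RingSolver using (solve-∀)
open import Data.Product using (_×_; _,_)
open import Level using (0ℓ)
open import Relation.Binary.PropositionalEquality
  using (_≡_; refl; sym; trans; cong; cong₂; module ≡-Reasoning)

open import Defs

open +-*-Solver using (Polynomial; solve; con; _:+_; _:*_; :-_; _:-_; _:=_)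
open ≡-Reasoning

-- Defined over a raw ring so that the ring solver can read the same expressions as
-- polynomials; over ℤ, _-_ below unfolds to Data.Integer._-_.
module Triples (R : RawRing 0ℓ 0ℓ) where

  open RawRing R

  private
    infixl 6 _-_
    _-_ : Carrier → Carrier → Carrier
    x - y = x + - y

  infix 5 _·_ _*ᵥ_
  infixr 6 _×ᵥ_

  Triple : Set
  Triple = Carrier × Carrier × Carrier

  _·_ : Triple → Triple → Carrier
  (x₀ , x₁ , x₂) · (y₀ , y₁ , y₂) = x₀ * y₀ + x₁ * y₁ + x₂ * y₂

  _×ᵥ_ : Triple → Triple → Triple
  (x₀ , x₁ , x₂) ×ᵥ (y₀ , y₁ , y₂) = x₁ * y₂ - x₂ * y₁ , x₂ * y₀ - x₀ * y₂ , x₀ * y₁ - x₁ * y₀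

  det : Triple → Triple → Triple → Carrier
  det u v w = u · v ×ᵥ w

  _*ᵥ_ : Triple × Triple × Triple → Triple → Triple
  (p , q , r) *ᵥ v = p · v , q · v , r · v

polynomialRawRing : ℕ → RawRing 0ℓ 0ℓ
polynomialRawRing n = record
  { Carrier = Polynomial n
  ; _≈_     = _≡_
  ; _+_     = _:+_
  ; _*_     = _:*_
  ; -_      = :-_
  ; 0#      = con (+ 0)
  ; 1#      = con (+ 1)
  }

module PolynomialTriples (n : ℕ) = Triples (polynomialRawRing n)

open Triples +-*-rawRing
open Data.Integer using (_+_; _-_; _*_; -_)

det-*ᵥ : ∀ p q r u v w → let P = p , q , r in det (P *ᵥ u) (P *ᵥ v) (P *ᵥ w) ≡ det p q r * det u v w
det-*ᵥ (p₀ , p₁ , p₂) (q₀ , q₁ , q₂) (r₀ , r₁ , r₂) (u₀ , u₁ , u₂) (v₀ , v₁ , v₂) (w₀ , w₁ , w₂) =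
  solve 18 (λ p₀ p₁ p₂ q₀ q₁ q₂ r₀ r₁ r₂ u₀ u₁ u₂ v₀ v₁ v₂ w₀ w₁ w₂ →
      let p = p₀ , p₁ , p₂ ; q = q₀ , q₁ , q₂ ; r = r₀ , r₁ , r₂ ; P = p , q , r
          u = u₀ , u₁ , u₂ ; v = v₀ , v₁ , v₂ ; w = w₀ , w₁ , w₂
      in :det (P :*ᵥ u) (P :*ᵥ v) (P :*ᵥ w) := :det p q r :* :det u v w)
    refl p₀ p₁ p₂ q₀ q₁ q₂ r₀ r₁ r₂ u₀ u₁ u₂ v₀ v₁ v₂ w₀ w₁ w₂
  where open PolynomialTriples 18 renaming (det to :det; _*ᵥ_ to _:*ᵥ_)

cramer : ∀ f u v w t → det u v w * (f · t) ≡ det t v w * (f · u) + det u t w * (f · v) + det u v t * (f · w)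
cramer (f₀ , f₁ , f₂) (u₀ , u₁ , u₂) (v₀ , v₁ , v₂) (w₀ , w₁ , w₂) (t₀ , t₁ , t₂) =
  solve 15 (λ f₀ f₁ f₂ u₀ u₁ u₂ v₀ v₁ v₂ w₀ w₁ w₂ t₀ t₁ t₂ →
      let f = f₀ , f₁ , f₂ ; u = u₀ , u₁ , u₂ ; v = v₀ , v₁ , v₂ ; w = w₀ , w₁ , w₂ ; t = t₀ , t₁ , t₂
      in :det u v w :* (f :· t) := :det t v w :* (f :· u) :+ :det u t w :* (f :· v) :+ :det u v t :* (f :· w))
    refl f₀ f₁ f₂ u₀ u₁ u₂ v₀ v₁ v₂ w₀ w₁ w₂ t₀ t₁ t₂
  where open PolynomialTriples 15 renaming (det to :det; _·_ to _:·_)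

gram-cramer : ∀ P f u v w t {U V W T : Triple} {fu fv fw ft : ℤ} →
  P *ᵥ u ≡ U → P *ᵥ v ≡ V → P *ᵥ w ≡ W → P *ᵥ t ≡ T →
  f · u ≡ fu → f · v ≡ fv → f · w ≡ fw → f · t ≡ ft →
  det U V W * ft ≡ det T V W * fu + det U T W * fv + det U V T * fw
gram-cramer P@(p , q , r) f u v w t refl refl refl refl refl refl refl refl = begin
  det (P *ᵥ u) (P *ᵥ v) (P *ᵥ w) * (f · t)
    ≡⟨ cong (_* (f · t)) (det-*ᵥ p q r u v w) ⟩
  det p q r * det u v w * (f · t)
    ≡⟨ *-assoc (det p q r) (det u v w) (f · t) ⟩
  det p q r * (det u v w * (f · t))
    ≡⟨ cong (det p q r *_) (cramer f u v w t) ⟩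
  det p q r * (det t v w * (f · u) + det u t w * (f · v) + det u v t * (f · w))
    ≡⟨ distribute (det p q r) (det t v w) (f · u) (det u t w) (f · v) (det u v t) (f · w) ⟩
  det p q r * det t v w * (f · u) + det p q r * det u t w * (f · v) + det p q r * det u v t * (f · w)
    ≡⟨ cong₂ _+_ (cong₂ _+_ (multiply t v w (f · u)) (multiply u t w (f · v))) (multiply u v t (f · w)) ⟩
  det (P *ᵥ t) (P *ᵥ v) (P *ᵥ w) * (f · u) + det (P *ᵥ u) (P *ᵥ t) (P *ᵥ w) * (f · v)
    + det (P *ᵥ u) (P *ᵥ v) (P *ᵥ t) * (f · w) ∎
  where
    distribute : ∀ d x₁ y₁ x₂ y₂ x₃ y₃ →
      d * (x₁ * y₁ + x₂ * y₂ + x₃ * y₃) ≡ d * x₁ * y₁ + d * x₂ * y₂ + d * x₃ * y₃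
    distribute = solve-∀
    multiply : ∀ u v w y → det p q r * det u v w * y ≡ det (P *ᵥ u) (P *ᵥ v) (P *ᵥ w) * y
    multiply u v w y = cong (_* y) (sym (det-*ᵥ p q r u v w))

cramer-neg-unit-diagonal : ∀ G₁₂ G₁₃ G₂₁ G₂₃ G₃₁ G₃₂ g₁ g₂ g₃ w₁ w₂ w₃ wt →
  let C₁ = -1ℤ , G₂₁ , G₃₁ ; C₂ = G₁₂ , -1ℤ , G₃₂ ; C₃ = G₁₃ , G₂₃ , -1ℤ ; g = g₁ , g₂ , g₃ in
  det C₁ C₂ C₃ * wt ≡ det g C₂ C₃ * w₁ + det C₁ g C₃ * w₂ + det C₁ C₂ g * w₃ →
  (G₁₂ * G₂₁ + G₁₂ * G₂₃ * G₃₁ + G₁₃ * G₃₂ * G₂₁ + G₁₃ * G₃₁ + G₂₃ * G₃₂ - + 1) * wt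
  ≡ ((+ 1 - G₂₃ * G₃₂) * g₁ + (G₁₂ + G₁₃ * G₃₂) * g₂ + (G₁₃ + G₁₂ * G₂₃) * g₃) * w₁
  + ((+ 1 - G₁₃ * G₃₁) * g₂ + (G₂₁ + G₂₃ * G₃₁) * g₁ + (G₂₃ + G₁₃ * G₂₁) * g₃) * w₂
  + ((+ 1 - G₁₂ * G₂₁) * g₃ + (G₃₂ + G₁₂ * G₃₁) * g₂ + (G₃₁ + G₃₂ * G₂₁) * g₁) * w₃
cramer-neg-unit-diagonal G₁₂ G₁₃ G₂₁ G₂₃ G₃₁ G₃₂ g₁ g₂ g₃ w₁ w₂ w₃ wt cramer-system =
  trans (cong (_* wt)
          (solve 6 (λ G₁₂ G₁₃ G₂₁ G₂₃ G₃₁ G₃₂ →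
              G₁₂ :* G₂₁ :+ G₁₂ :* G₂₃ :* G₃₁ :+ G₁₃ :* G₃₂ :* G₂₁ :+ G₁₃ :* G₃₁ :+ G₂₃ :* G₃₂ :- con (+ 1)
              := PolynomialTriples.det 6 (con -1ℤ , G₂₁ , G₃₁) (G₁₂ , con -1ℤ , G₃₂) (G₁₃ , G₂₃ , con -1ℤ))
            refl G₁₂ G₁₃ G₂₁ G₂₃ G₃₁ G₃₂))
  (trans cramer-system
    (solve 13 (λ G₁₂ G₁₃ G₂₁ G₂₃ G₃₁ G₃₂ g₁ g₂ g₃ w₁ w₂ w₃ wt →
        let C₁ = con -1ℤ , G₂₁ , G₃₁ ; C₂ = G₁₂ , con -1ℤ , G₃₂ ; C₃ = G₁₃ , G₂₃ , con -1ℤ ; g = g₁ , g₂ , g₃ in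
        :det g C₂ C₃ :* w₁ :+ :det C₁ g C₃ :* w₂ :+ :det C₁ C₂ g :* w₃
        := ((con (+ 1) :- G₂₃ :* G₃₂) :* g₁ :+ (G₁₂ :+ G₁₃ :* G₃₂) :* g₂ :+ (G₁₃ :+ G₁₂ :* G₂₃) :* g₃) :* w₁
        :+ ((con (+ 1) :- G₁₃ :* G₃₁) :* g₂ :+ (G₂₁ :+ G₂₃ :* G₃₁) :* g₁ :+ (G₂₃ :+ G₁₃ :* G₂₁) :* g₃) :* w₂
        :+ ((con (+ 1) :- G₁₂ :* G₂₁) :* g₃ :+ (G₃₂ :+ G₁₂ :* G₃₁) :* g₂ :+ (G₃₁ :+ G₃₂ :* G₂₁) :* g₁) :* w₃)
      refl G₁₂ G₁₃ G₂₁ G₂₃ G₃₁ G₃₂ g₁ g₂ g₃ w₁ w₂ w₃ wt))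
  where open PolynomialTriples 13 renaming (det to :det)

Tribonacci : (ℤ → ℤ) → Set
Tribonacci f = ∀ n → f (+ 3 + n) ≡ f (+ 2 + n) + f (+ 1 + n) + f n

W-backward : ∀ x y z j → W x y z -[1+ j ] ≡
  W x y z (+ 3 + -[1+ j ]) - W x y z (+ 2 + -[1+ j ]) - W x y z (+ 1 + -[1+ j ])
W-backward x y z 0 = refl
W-backward x y z 1 = refl
W-backward x y z 2 = refl
W-backward x y z (suc (suc (suc j))) = refl

W-tribonacci : ∀ x y z → Tribonacci (W x y z)
W-tribonacci x y z (+ k) = x+y+z≡z+y+x (W x y z (+ k)) _ _
  where
    x+y+z≡z+y+x : ∀ x y z → x + y + z ≡ z + y + x
    x+y+z≡z+y+x = solve-∀
W-tribonacci x y z n@(-[1+ j ]) = begin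
  w (+ 3 + n)
    ≡⟨ x≡y+z+[x-y-z] (w (+ 3 + n)) (w (+ 2 + n)) (w (+ 1 + n)) ⟩
  w (+ 2 + n) + w (+ 1 + n) + (w (+ 3 + n) - w (+ 2 + n) - w (+ 1 + n))
    ≡⟨ cong (_+_ (w (+ 2 + n) + w (+ 1 + n))) (sym (W-backward x y z j)) ⟩
  w (+ 2 + n) + w (+ 1 + n) + w n ∎
  where
    w : ℤ → ℤ
    w = W x y z
    x≡y+z+[x-y-z] : ∀ x y z → x ≡ y + z + (x - y - z)
    x≡y+z+[x-y-z] = solve-∀

module _ {f g : ℤ → ℤ} (f-trib : Tribonacci f) (g-trib : Tribonacci g) where

  private
    step-up : ∀ n → f (+ 2 + n) ≡ g (+ 2 + n) → f (+ 1 + n) ≡ g (+ 1 + n) → f n ≡ g n →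
              f (+ 3 + n) ≡ g (+ 3 + n)
    step-up n e₂ e₁ e₀ = begin
      f (+ 3 + n)                         ≡⟨ f-trib n ⟩
      f (+ 2 + n) + f (+ 1 + n) + f n     ≡⟨ cong₂ _+_ (cong₂ _+_ e₂ e₁) e₀ ⟩
      g (+ 2 + n) + g (+ 1 + n) + g n     ≡⟨ sym (g-trib n) ⟩
      g (+ 3 + n)                         ∎

    isolate : ∀ {x y z w} → x ≡ y + z + w → w ≡ x - y - z
    isolate {y = y} {z} {w} refl = w≡y+z+w-y-z y z w
      where
        w≡y+z+w-y-z : ∀ y z w → w ≡ y + z + w - y - z
        w≡y+z+w-y-z = solve-∀

    step-down : ∀ n → f (+ 3 + n) ≡ g (+ 3 + n) → f (+ 2 + n) ≡ g (+ 2 + n) → f (+ 1 + n) ≡ g (+ 1 + n) →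
                f n ≡ g n
    step-down n e₃ e₂ e₁ = begin
      f n                                         ≡⟨ isolate (f-trib n) ⟩
      f (+ 3 + n) - f (+ 2 + n) - f (+ 1 + n)     ≡⟨ cong₂ _-_ (cong₂ _-_ e₃ e₂) e₁ ⟩
      g (+ 3 + n) - g (+ 2 + n) - g (+ 1 + n)     ≡⟨ sym (isolate (g-trib n)) ⟩
      g n                                         ∎

  tribonacci-ext : f (+ 0) ≡ g (+ 0) → f (+ 1) ≡ g (+ 1) → f (+ 2) ≡ g (+ 2) → ∀ n → f n ≡ g n
  tribonacci-ext e₀ e₁ e₂ (+ k)    = agree⁺ k
    where
      agree⁺ : ∀ k → f (+ k) ≡ g (+ k)
      agree⁺ 0 = e₀
      agree⁺ 1 = e₁
      agree⁺ 2 = e₂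
      agree⁺ (suc (suc (suc k))) = step-up (+ k) (agree⁺ (suc (suc k))) (agree⁺ (suc k)) (agree⁺ k)
  tribonacci-ext e₀ e₁ e₂ -[1+ k ] = agree⁻ k
    where
      agree⁻ : ∀ k → f -[1+ k ] ≡ g -[1+ k ]
      agree⁻ 0 = step-down -[1+ 0 ] (tribonacci-ext e₀ e₁ e₂ (+ 2)) (tribonacci-ext e₀ e₁ e₂ (+ 1)) e₀
      agree⁻ 1 = step-down -[1+ 1 ] (tribonacci-ext e₀ e₁ e₂ (+ 1)) e₀ (agree⁻ 0)
      agree⁻ 2 = step-down -[1+ 2 ] e₀ (agree⁻ 0) (agree⁻ 1)
      agree⁻ (suc (suc (suc k))) = step-down -[1+ suc (suc (suc k)) ] (agree⁻ k) (agree⁻ (suc k)) (agree⁻ (suc (suc k)))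

basis : ℤ → Triple
basis n = W (+ 1) (+ 0) (+ 0) n , W (+ 0) (+ 1) (+ 0) n , W (+ 0) (+ 0) (+ 1) n

window : (ℤ → ℤ) → ℤ → Triple
window f m = f m , f (m + + 1) , f (m + + 2)

·-tribonacci : ∀ {f₀ f₁ f₂} x → Tribonacci f₀ → Tribonacci f₁ → Tribonacci f₂ →
               Tribonacci (λ n → x · (f₀ n , f₁ n , f₂ n))
·-tribonacci (x₀ , x₁ , x₂) t₀ t₁ t₂ n =
  trans (cong₂ _+_ (cong₂ _+_ (cong (x₀ *_) (t₀ n)) (cong (x₁ *_) (t₁ n))) (cong (x₂ *_) (t₂ n)))
        (regroup x₀ x₁ x₂ _ _ _ _ _ _ _ _ _)
  where
    regroup : ∀ x₀ x₁ x₂ a₀ b₀ c₀ a₁ b₁ c₁ a₂ b₂ c₂ →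
      x₀ * (a₀ + b₀ + c₀) + x₁ * (a₁ + b₁ + c₁) + x₂ * (a₂ + b₂ + c₂)
      ≡ (x₀ * a₀ + x₁ * a₁ + x₂ * a₂) + (x₀ * b₀ + x₁ * b₁ + x₂ * b₂) + (x₀ * c₀ + x₁ * c₁ + x₂ * c₂)
    regroup = solve-∀

shift-tribonacci : ∀ f → Tribonacci f → ∀ m → Tribonacci (λ n → f (m + n))
shift-tribonacci f f-trib m n = begin
  f (m + (+ 3 + n))                                      ≡⟨ cong f (x∙yz≈y∙xz m (+ 3) n) ⟩
  f (+ 3 + (m + n))                                      ≡⟨ f-trib (m + n) ⟩
  f (+ 2 + (m + n)) + f (+ 1 + (m + n)) + f (m + n)      ≡⟨ cong₂ _+_ (cong₂ _+_ (shift (+ 2)) (shift (+ 1))) refl ⟩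
  f (m + (+ 2 + n)) + f (m + (+ 1 + n)) + f (m + n)      ∎
  where
    shift : ∀ k → f (k + (m + n)) ≡ f (m + (k + n))
    shift k = cong f (x∙yz≈y∙xz k m n)

addition-formula : ∀ f → Tribonacci f → ∀ m n → window f m · basis n ≡ f (m + n)
addition-formula f f-trib m =
  tribonacci-ext (·-tribonacci (window f m) (W-tribonacci (+ 1) (+ 0) (+ 0))
                   (W-tribonacci (+ 0) (+ 1) (+ 0)) (W-tribonacci (+ 0) (+ 0) (+ 1)))
                 (shift-tribonacci f f-trib m)
                 (trans (x*1+y*0+z*0≡x (f m) (f (m + + 1)) (f (m + + 2))) (cong f (sym (+-identityʳ m))))
                 (x*0+y*1+z*0≡y (f m) (f (m + + 1)) (f (m + + 2)))
                 (x*0+y*0+z*1≡z (f m) (f (m + + 1)) (f (m + + 2)))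
  where
    x*1+y*0+z*0≡x : ∀ x y z → x * + 1 + y * + 0 + z * + 0 ≡ x
    x*1+y*0+z*0≡x = solve-∀
    x*0+y*1+z*0≡y : ∀ x y z → x * + 0 + y * + 1 + z * + 0 ≡ y
    x*0+y*1+z*0≡y = solve-∀
    x*0+y*0+z*1≡z : ∀ x y z → x * + 0 + y * + 0 + z * + 1 ≡ z
    x*0+y*0+z*1≡z = solve-∀

tribonacci-identity : ∀ k w → Tribonacci k → Tribonacci w → k -1ℤ ≡ -1ℤ → (a b c d e : ℤ) →
    (k (b - a - + 1) * k (a - b - + 1)
      + k (b - a - + 1) * k (c - b - + 1) * k (a - c - + 1)
      + k (c - a - + 1) * k (b - c - + 1) * k (a - b - + 1)
      + k (c - a - + 1) * k (a - c - + 1)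
      + k (c - b - + 1) * k (b - c - + 1) - + 1) * w (d + e)
    ≡
    ((+ 1 - k (c - b - + 1) * k (b - c - + 1)) * k (e - a)
      + (k (b - a - + 1) + k (c - a - + 1) * k (b - c - + 1)) * k (e - b)
      + (k (c - a - + 1) + k (b - a - + 1) * k (c - b - + 1)) * k (e - c))
      * w (d + a - + 1)
    + ((+ 1 - k (c - a - + 1) * k (a - c - + 1)) * k (e - b)
      + (k (a - b - + 1) + k (c - b - + 1) * k (a - c - + 1)) * k (e - a)
      + (k (c - b - + 1) + k (c - a - + 1) * k (a - b - + 1)) * k (e - c))
      * w (d + b - + 1)
    + ((+ 1 - k (b - a - + 1) * k (a - b - + 1)) * k (e - c)
      + (k (b - c - + 1) + k (b - a - + 1) * k (a - c - + 1)) * k (e - b)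
      + (k (a - c - + 1) + k (b - c - + 1) * k (a - b - + 1)) * k (e - a))
      * w (d + c - + 1)
tribonacci-identity k w k-trib w-trib k₋₁ a b c d e =
  cramer-neg-unit-diagonal
    (k (b - a - + 1)) (k (c - a - + 1)) (k (a - b - + 1)) (k (c - b - + 1)) (k (a - c - + 1)) (k (b - c - + 1))
    (k (e - a)) (k (e - b)) (k (e - c)) (w (d + a - + 1)) (w (d + b - + 1)) (w (d + c - + 1)) (w (d + e))
    (gram-cramer P (window w d) (basis (a - + 1)) (basis (b - + 1)) (basis (c - + 1)) (basis e)
      (cong₂ _,_ (diagonal a) (cong₂ _,_ (entry b a) (entry c a)))
      (cong₂ _,_ (entry a b) (cong₂ _,_ (diagonal b) (entry c b)))
      (cong₂ _,_ (entry a c) (cong₂ _,_ (entry b c) (diagonal c)))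
      (cong₂ _,_ (shifted a) (cong₂ _,_ (shifted b) (shifted c)))
      (value a) (value b) (value c) (addition-formula w w-trib d e))
  where
    P : Triple × Triple × Triple
    P = window k (- a) , window k (- b) , window k (- c)

    entry : ∀ x y → window k (- x) · basis (y - + 1) ≡ k (y - x - + 1)
    entry x y = trans (addition-formula k k-trib (- x) (y - + 1)) (cong k (-x+[y-1]≡y-x-1 x y))
      where
        -x+[y-1]≡y-x-1 : ∀ x y → - x + (y - + 1) ≡ y - x - + 1
        -x+[y-1]≡y-x-1 = solve-∀

    diagonal : ∀ x → window k (- x) · basis (x - + 1) ≡ -1ℤ
    diagonal x = trans (entry x x) (trans (cong (λ i → k (i - + 1)) (+-inverseʳ x)) k₋₁)

    shifted : ∀ x → window k (- x) · basis e ≡ k (e - x)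
    shifted x = trans (addition-formula k k-trib (- x) e) (cong k (+-comm (- x) e))

    value : ∀ x → window w d · basis (x - + 1) ≡ w (d + x - + 1)
    value x = trans (addition-formula w w-trib d (x - + 1)) (cong w (sym (+-assoc d x (- + 1))))

theorem3 : (W₀ W₁ W₂ : ℤ) → ¬AllZero W₀ W₁ W₂ → (a b c d e : ℤ) →
    (K (b - a - + 1) * K (a - b - + 1)
      + K (b - a - + 1) * K (c - b - + 1) * K (a - c - + 1)
      + K (c - a - + 1) * K (b - c - + 1) * K (a - b - + 1)
      + K (c - a - + 1) * K (a - c - + 1)
      + K (c - b - + 1) * K (b - c - + 1) - + 1) * W W₀ W₁ W₂ (d + e)
    ≡
    ((+ 1 - K (c - b - + 1) * K (b - c - + 1)) * K (e - a)
      + (K (b - a - + 1) + K (c - a - + 1) * K (b - c - + 1)) * K (e - b)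
      + (K (c - a - + 1) + K (b - a - + 1) * K (c - b - + 1)) * K (e - c))
      * W W₀ W₁ W₂ (d + a - + 1)
    + ((+ 1 - K (c - a - + 1) * K (a - c - + 1)) * K (e - b)
      + (K (a - b - + 1) + K (c - b - + 1) * K (a - c - + 1)) * K (e - a)
      + (K (c - b - + 1) + K (c - a - + 1) * K (a - b - + 1)) * K (e - c))
      * W W₀ W₁ W₂ (d + b - + 1)
    + ((+ 1 - K (b - a - + 1) * K (a - b - + 1)) * K (e - c)
      + (K (b - c - + 1) + K (b - a - + 1) * K (a - c - + 1)) * K (e - b)
      + (K (a - c - + 1) + K (b - c - + 1) * K (a - b - + 1)) * K (e - a))
      * W W₀ W₁ W₂ (d + c - + 1)
theorem3 W₀ W₁ W₂ _ =
  tribonacci-identity K (W W₀ W₁ W₂) (W-tribonacci (+ 3) (+ 1) (+ 3)) (W-tribonacci W₀ W₁ W₂) refl
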